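{- Let $C_5$ be a set of five points in convex and general position in the plane, and let $\gamma$ be a coloring of $D(C_5)$ with exactly four colors. If every point of $C_5$ is an apex of some star of $\gamma$, then there are two points $p,q\in C_5$ such that the single segment $pq$ forms a whole chromatic class of $\gamma$ (a 2-star), and neither $p$ nor $q$ is an apex of any other star of $\gamma$.
   Context: $D(P)$ is the graph whose vertices are the closed segments with both endpoints in $P$, adjacent iff disjoint; a coloring of $D(P)$ is an assignment of colors to these segments such that any two segments of the same color cross or share an endpoint. A chromatic class (set of segments of one color) is a star if no two of its segments cross. An apex of a star is a point incident with all segments of the star; if a star consists of a single segment (a 2-star), both endpoints are its apices.
   Formalization: The points of $C_5$ have rational coordinates, and the convex combinations defining convex position and common points of segments use rational coefficients. -}

module Defs where

open import Data.Rational using (ℚ; _+_; _*_; _-_; _≤_; _<_; 0ℚ; 1ℚ)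
open import Data.Fin using (Fin)
open import Data.Fin.Patterns using (0F; 1F; 2F; 3F; 4F)
import Data.Fin as F
open import Data.Product using (_×_; _,_; proj₁; proj₂; Σ; ∃; ∃-syntax)
open import Data.Sum using (_⊎_)
open import Relation.Binary.PropositionalEquality using (_≡_; _≢_)
open import Relation.Nullary using (¬_)

Point : Set
Point = ℚ × ℚ

orient : Point → Point → Point → ℚ
orient (px , py) (qx , qy) (rx , ry) =
  ((qx - px) * (ry - py)) - ((qy - py) * (rx - px))

Collinear : Point → Point → Point → Set
Collinear p q r = orient p q r ≡ 0ℚ

Config : Set
Config = Fin 5 → Point

-- General position: no three (distinct-label) points are collinear
-- (this also forces the five points to be pairwise distinct).
GeneralPosition : Config → Set
GeneralPosition P = ∀ i j k → i ≢ j → j ≢ k → i ≢ k → ¬ Collinear (P i) (P j) (P k)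

sum5 : (Fin 5 → ℚ) → ℚ
sum5 f = f 0F + f 1F + f 2F + f 3F + f 4F

InHullOfOthers : Config → Fin 5 → Set
InHullOfOthers P l =
  Σ (Fin 5 → ℚ) λ w →
    (w l ≡ 0ℚ) ×
    (∀ i → 0ℚ ≤ w i) ×
    (sum5 w ≡ 1ℚ) ×
    (sum5 (λ i → w i * proj₁ (P i)) ≡ proj₁ (P l)) ×
    (sum5 (λ i → w i * proj₂ (P i)) ≡ proj₂ (P l))

ConvexPosition : Config → Set
ConvexPosition P = ∀ l → ¬ InHullOfOthers P l

record Seg : Set where
  constructor seg
  field
    a   : Fin 5
    b   : Fin 5
    a<b : a F.< b
open Seg public

SameSeg : Seg → Seg → Set
SameSeg s t = (a s ≡ a t) × (b s ≡ b t)

IncidentTo : Fin 5 → Seg → Set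
IncidentTo p s = (p ≡ a s) ⊎ (p ≡ b s)

ShareEndpoint : Seg → Seg → Set
ShareEndpoint s t = ∃[ p ] (IncidentTo p s × IncidentTo p t)

along : Point → Point → ℚ → Point
along (x₁ , x₂) (y₁ , y₂) t = (x₁ + t * (y₁ - x₁)) , (x₂ + t * (y₂ - x₂))

Intersect : Config → Seg → Seg → Set
Intersect P s t =
  ∃[ λ₁ ] ∃[ λ₂ ] (0ℚ ≤ λ₁ × λ₁ ≤ 1ℚ × 0ℚ ≤ λ₂ × λ₂ ≤ 1ℚ ×
    along (P (a s)) (P (b s)) λ₁ ≡ along (P (a t)) (P (b t)) λ₂)

Disjoint : Config → Seg → Seg → Set
Disjoint P s t = ¬ Intersect P s t

Cross : Config → Seg → Seg → Set
Cross P s t = Intersect P s t × ¬ ShareEndpoint s t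

IsColoring : ∀ {k} → Config → (Seg → Fin k) → Set
IsColoring P γ = ∀ s t → γ s ≡ γ t → ¬ SameSeg s t → ¬ Disjoint P s t

-- Exactly k colors: every color is used.
AllColorsUsed : ∀ {k} → (Seg → Fin k) → Set
AllColorsUsed γ = ∀ c → ∃[ s ] (γ s ≡ c)

IsStar : ∀ {k} → Config → (Seg → Fin k) → Fin k → Set
IsStar P γ c = ∀ s t → γ s ≡ c → γ t ≡ c → ¬ Cross P s t

IncidentToClass : ∀ {k} → (Seg → Fin k) → Fin 5 → Fin k → Set
IncidentToClass γ p c = ∀ s → γ s ≡ c → IncidentTo p s

IsApexOfStar : ∀ {k} → Config → (Seg → Fin k) → Fin 5 → Fin k → Set
IsApexOfStar P γ p c = IsStar P γ c × IncidentToClass γ p c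

{-# OPTIONS --safe #-}
-- Say that a point k covers a colour x when every segment of colour x is incident to k
-- (IncidentToClass γ k x).  A colour covered by two points i ≠ j is the
-- single segment ij, so no colour is covered by three points.  Each point covers a colour and
-- there are only four colours, so two points p, q cover a common colour and pq is a whole class.
-- A further colour x covered by p is impossible as soon as p, u, v cover colours forming with x
-- four distinct colours: the segment qr to the fifth point r would have a colour covered by a
-- point off it.  If r, u, v cover three distinct colours, this shows that pq is the segment
-- sought.  Otherwise, say, u and v cover a common colour, uv is a second one-segment class, and
-- a segment of the colour covered by r misses p and q or misses u and v; that pair is the one.
module Submission where

open import Defs
open import Data.Fin using (Fin)
open import Data.Product using (_×_; ∃; ∃-syntax)
open import Relation.Binary.PropositionalEquality using (_≡_; _≢_)
open import Relation.Nullary using (¬_)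

open import Data.Empty using (⊥-elim)
open import Data.Fin using (_<_)
open import Data.Fin.Patterns using (0F; 1F; 2F; 3F; 4F)
open import Data.Fin.Permutation using (Permutation′; _⟨$⟩ʳ_; transpose; _∘ₚ_)
import Data.Fin.Permutation.Components as PC
open import Data.Fin.Properties
  using (_≟_; <-cmp; <-asym; <-irrefl; <⇒≢; pigeonhole; <⇒notInjective)
open import Data.Nat.Properties using (n<1+n; n≮0)
open import Data.Product using (_,_; proj₁; proj₂)
open import Data.Sum using (_⊎_; inj₁; inj₂; [_,_]′; swap)
open import Data.Vec using (Vec; []; _∷_)
open import Data.Vec.Membership.Propositional using (_∈_)
open import Data.Vec.Relation.Unary.All as All using (All; []; _∷_)
open import Data.Vec.Relation.Unary.AllPairs using ([]; _∷_)
open import Data.Vec.Relation.Unary.Unique.Propositional using (Unique)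
open import Data.Vec.Relation.Unary.Unique.Propositional.Properties using (lookup-injective)
open import Function using (_∘_)
open import Function.Bundles using (Injection)
open import Function.Properties.Inverse using (↔⇒↣)
open import Relation.Binary.Definitions using (tri<; tri≈; tri>)
open import Relation.Binary.PropositionalEquality using (refl; sym; trans; cong; subst; ≢-sym)
open import Relation.Nullary using (Dec; yes; no)
open import Relation.Nullary.Decidable using (dec-true; dec-false; toSum; _⊎-dec_)

IncidentTo? : ∀ k t → Dec (IncidentTo k t)
IncidentTo? k t = (k ≟ a t) ⊎-dec (k ≟ b t)

IncidentTo-pair : ∀ t {i j k} → i ≢ j → IncidentTo i t → IncidentTo j t →
  IncidentTo k t → k ≡ i ⊎ k ≡ j
IncidentTo-pair _ i≢j (inj₁ refl) (inj₁ refl) _   = ⊥-elim (i≢j refl)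
IncidentTo-pair _ _   (inj₁ refl) (inj₂ refl) k∈t = k∈t
IncidentTo-pair _ _   (inj₂ refl) (inj₁ refl) k∈t = swap k∈t
IncidentTo-pair _ i≢j (inj₂ refl) (inj₂ refl) _   = ⊥-elim (i≢j refl)

¬IncidentTo-pair : ∀ t {i j k} → i ≢ j → IncidentTo i t → IncidentTo j t →
  k ≢ i → k ≢ j → ¬ IncidentTo k t
¬IncidentTo-pair t i≢j i∈t j∈t k≢i k≢j k∈t = [ k≢i , k≢j ]′ (IncidentTo-pair t i≢j i∈t j∈t k∈t)

Incidence⇒SameSeg : ∀ s t → (∀ {k} → IncidentTo k s → IncidentTo k t) → SameSeg s t
Incidence⇒SameSeg (seg _ _ ordered) t s⊆t with s⊆t (inj₁ refl) | s⊆t (inj₂ refl)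
... | inj₁ a≡ | inj₂ b≡ = a≡ , b≡
... | inj₂ refl | inj₁ refl = ⊥-elim (<-asym ordered (a<b t))
... | inj₁ refl | inj₁ refl = ⊥-elim (<-irrefl refl ordered)
... | inj₂ refl | inj₂ refl = ⊥-elim (<-irrefl refl ordered)

IncidentTo-pair⇒SameSeg : ∀ s t {i j} → i ≢ j → IncidentTo i s → IncidentTo j s →
  IncidentTo i t → IncidentTo j t → SameSeg s t
IncidentTo-pair⇒SameSeg s t i≢j i∈s j∈s i∈t j∈t = Incidence⇒SameSeg s t λ k∈s →
  [ (λ { refl → i∈t }) , (λ { refl → j∈t }) ]′ (IncidentTo-pair s i≢j i∈s j∈s k∈s)

edge : (i j : Fin 5) → i ≢ j → Seg
edge i j i≢j with <-cmp i j
... | tri< i<j _ _ = seg i j i<j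
... | tri≈ _ i≡j _ = ⊥-elim (i≢j i≡j)
... | tri> _ _ j<i = seg j i j<i

edge-incident : ∀ i j (i≢j : i ≢ j) → IncidentTo i (edge i j i≢j) × IncidentTo j (edge i j i≢j)
edge-incident i j i≢j with <-cmp i j
... | tri< _ _ _ = inj₁ refl , inj₂ refl
... | tri≈ _ i≡j _ = ⊥-elim (i≢j i≡j)
... | tri> _ _ _ = inj₂ refl , inj₁ refl

¬IncidentTo-edge : ∀ {i j k} (i≢j : i ≢ j) → k ≢ i → k ≢ j → ¬ IncidentTo k (edge i j i≢j)
¬IncidentTo-edge {i} {j} i≢j = ¬IncidentTo-pair (edge i j i≢j) i≢j i∈ij j∈ij
  where
  i∈ij : IncidentTo i (edge i j i≢j)
  i∈ij = proj₁ (edge-incident i j i≢j)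
  j∈ij : IncidentTo j (edge i j i≢j)
  j∈ij = proj₂ (edge-incident i j i≢j)

Unique⇒∈ : ∀ {n} {xs : Vec (Fin n) n} → Unique xs → ∀ y → y ∈ xs
Unique⇒∈ {xs = xs} xs! y with All.decide (λ x → swap (toSum (y ≟ x))) xs
... | inj₂ y∈xs = y∈xs
... | inj₁ y∉xs =
  ⊥-elim (<⇒notInjective (n<1+n _) λ {i} {j} → lookup-injective {xs = y ∷ xs} (y∉xs ∷ xs!) i j)

transpose-matchˡ : ∀ {n} (i j : Fin n) → PC.transpose i j i ≡ j
transpose-matchˡ i j rewrite dec-true (i ≟ i) refl = refl

transpose-fix : ∀ {n} (i j : Fin n) {k} → k ≢ i → k ≢ j → PC.transpose i j k ≡ k
transpose-fix i j {k} k≢i k≢j rewrite dec-false (k ≟ i) k≢i | dec-false (k ≟ j) k≢j = refl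

⟨$⟩ʳ-≢ : ∀ {n} (π : Permutation′ n) {i j} → i ≢ j → π ⟨$⟩ʳ i ≢ π ⟨$⟩ʳ j
⟨$⟩ʳ-≢ π i≢j = i≢j ∘ Injection.injective (↔⇒↣ π)

labelling : ∀ {i j : Fin 5} → i < j → ∃[ π ] (π ⟨$⟩ʳ 0F ≡ i × π ⟨$⟩ʳ 1F ≡ j)
labelling {i} {j} i<j = transpose 1F j ∘ₚ transpose 0F i , π0≡i , π1≡j
  where
  j≢0 : j ≢ 0F
  j≢0 refl = n≮0 i<j
  π0≡i : PC.transpose 0F i (PC.transpose 1F j 0F) ≡ i
  π0≡i = trans (cong (PC.transpose 0F i) (transpose-fix 1F j (λ ()) (≢-sym j≢0)))
               (transpose-matchˡ 0F i)
  π1≡j : PC.transpose 0F i (PC.transpose 1F j 1F) ≡ j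
  π1≡j = trans (cong (PC.transpose 0F i) (transpose-matchˡ 1F j))
               (transpose-fix 0F i j≢0 (≢-sym (<⇒≢ i<j)))

colliding-labelling : (f : Fin 5 → Fin 4) → ∃[ π ] (f (π ⟨$⟩ʳ 0F) ≡ f (π ⟨$⟩ʳ 1F))
colliding-labelling f with pigeonhole (n<1+n 4) f
... | i , j , i<j , fᵢ≡fⱼ with labelling i<j
... | π , refl , refl = π , fᵢ≡fⱼ

-- The five points are named through a permutation π; precomposing π with one of the swaps
-- below renames them, which is how symmetric cases are reduced to one another.
module Labelled (π : Permutation′ 5) where
  p q r u v : Fin 5
  p = π ⟨$⟩ʳ 0F
  q = π ⟨$⟩ʳ 1F
  r = π ⟨$⟩ʳ 2F
  u = π ⟨$⟩ʳ 3F
  v = π ⟨$⟩ʳ 4F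

  distinct : ∀ {i j} → i ≢ j → π ⟨$⟩ʳ i ≢ π ⟨$⟩ʳ j
  distinct = ⟨$⟩ʳ-≢ π

  segment-misses-third : ∀ t {i j k} → i ≢ j → k ≢ i → k ≢ j →
    IncidentTo (π ⟨$⟩ʳ i) t → IncidentTo (π ⟨$⟩ʳ j) t → ¬ IncidentTo (π ⟨$⟩ʳ k) t
  segment-misses-third t i≢j k≢i k≢j i∈t j∈t =
    ¬IncidentTo-pair t (distinct i≢j) i∈t j∈t (distinct k≢i) (distinct k≢j)

  segment-at-r-misses-pq-or-uv : ∀ t → IncidentTo r t →
    (¬ IncidentTo p t × ¬ IncidentTo q t) ⊎ (¬ IncidentTo u t × ¬ IncidentTo v t)
  segment-at-r-misses-pq-or-uv t r∈t with IncidentTo? p t | IncidentTo? q t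
  ... | yes p∈t | _ = inj₂ ( segment-misses-third t (λ ()) (λ ()) (λ ()) r∈t p∈t
                          , segment-misses-third t (λ ()) (λ ()) (λ ()) r∈t p∈t )
  ... | no _ | yes q∈t = inj₂ ( segment-misses-third t (λ ()) (λ ()) (λ ()) r∈t q∈t
                             , segment-misses-third t (λ ()) (λ ()) (λ ()) r∈t q∈t )
  ... | no p∉t | no q∉t = inj₁ (p∉t , q∉t)

swap-pq swap-ru swap-rv swap-pairs : Permutation′ 5
swap-pq = transpose 0F 1F
swap-ru = transpose 2F 3F
swap-rv = transpose 2F 4F
swap-pairs = transpose 0F 3F ∘ₚ transpose 1F 4F

unique₄ : ∀ {A : Set} {w x y z : A} → w ≢ x → w ≢ y → w ≢ z → x ≢ y → x ≢ z → y ≢ z →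
  Unique (w ∷ x ∷ y ∷ z ∷ [])
unique₄ w≢x w≢y w≢z x≢y x≢z y≢z =
  (w≢x ∷ w≢y ∷ w≢z ∷ []) ∷ (x≢y ∷ x≢z ∷ []) ∷ (y≢z ∷ []) ∷ [] ∷ []

module Colouring {n} (γ : Seg → Fin n) (used : AllColorsUsed γ) where

  SingletonClass : Seg → Set
  SingletonClass s = ∀ t → γ t ≡ γ s → SameSeg t s

  CoversOnly : Fin 5 → Fin n → Set
  CoversOnly k x = ∀ y → y ≢ x → ¬ IncidentToClass γ k y

  CoveredOff : Seg → Fin n → Set
  CoveredOff t x = ∃[ k ] (IncidentToClass γ k x × ¬ IncidentTo k t)

  Unique⇒¬All-CoveredOff : ∀ t {xs : Vec (Fin n) n} → Unique xs → ¬ All (CoveredOff t) xs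
  Unique⇒¬All-CoveredOff t xs! covered-off with All.lookup covered-off (Unique⇒∈ xs! (γ t))
  ... | k , k-covers , k∉t = k∉t (k-covers t refl)

  at-most-two-coverers : ∀ {i j k x} → i ≢ j →
    IncidentToClass γ i x → IncidentToClass γ j x → IncidentToClass γ k x → k ≡ i ⊎ k ≡ j
  at-most-two-coverers {x = x} i≢j i-covers j-covers k-covers with used x
  ... | s , s-col = IncidentTo-pair s i≢j (i-covers s s-col) (j-covers s s-col) (k-covers s s-col)

  Isolated : Seg → Set
  Isolated s = SingletonClass s × CoversOnly (a s) (γ s) × CoversOnly (b s) (γ s)

  co-covered-isolated : ∀ {i j} x → i ≢ j → IncidentToClass γ i x → IncidentToClass γ j x →
    CoversOnly i x → CoversOnly j x → ∃ Isolated
  co-covered-isolated {i} {j} x i≢j i-covers j-covers i-only j-only with used x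
  ... | s , refl = s , singleton , endpoint-only (inj₁ refl) , endpoint-only (inj₂ refl)
    where
    singleton : SingletonClass s
    singleton t t-col = IncidentTo-pair⇒SameSeg t s i≢j
      (i-covers t t-col) (j-covers t t-col) (i-covers s refl) (j-covers s refl)
    endpoint-only : ∀ {k} → IncidentTo k s → CoversOnly k (γ s)
    endpoint-only k∈s = [ (λ { refl → i-only }) , (λ { refl → j-only }) ]′
      (IncidentTo-pair s i≢j (i-covers s refl) (j-covers s refl) k∈s)

module FivePoints (γ : Seg → Fin 4) (used : AllColorsUsed γ)
                  (c : Fin 5 → Fin 4) (covers : ∀ k → IncidentToClass γ k (c k)) where
  open Colouring γ used

  shared-colour-excludes : ∀ {i j k} → i ≢ j → c i ≡ c j → k ≢ i → k ≢ j → c i ≢ c k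
  shared-colour-excludes {i} {j} {k} i≢j cᵢ≡cⱼ k≢i k≢j cᵢ≡cₖ = [ k≢i , k≢j ]′
    (at-most-two-coverers i≢j (covers i)
      (subst (IncidentToClass γ j) (sym cᵢ≡cⱼ) (covers j))
      (subst (IncidentToClass γ k) (sym cᵢ≡cₖ) (covers k)))

  ¬covers-fourth-colour : ∀ π {x} → let open Labelled π in
    Unique (c p ∷ c u ∷ c v ∷ x ∷ []) → ¬ IncidentToClass γ p x
  -- The colour of qr is one of the four, yet each of them is covered by a point off qr.
  ¬covers-fourth-colour π colours! p-covers-x = Unique⇒¬All-CoveredOff qr colours!
    ( (p , covers p , p∉qr) ∷ (u , covers u , u∉qr) ∷ (v , covers v , v∉qr)
    ∷ (p , p-covers-x , p∉qr) ∷ [] )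
    where
    open Labelled π
    qr : Seg
    qr = edge q r (distinct λ ())
    p∉qr : ¬ IncidentTo p qr
    p∉qr = ¬IncidentTo-edge (distinct λ ()) (distinct λ ()) (distinct λ ())
    u∉qr : ¬ IncidentTo u qr
    u∉qr = ¬IncidentTo-edge (distinct λ ()) (distinct λ ()) (distinct λ ())
    v∉qr : ¬ IncidentTo v qr
    v∉qr = ¬IncidentTo-edge (distinct λ ()) (distinct λ ()) (distinct λ ())

  shared-colour-≢-others : ∀ π → let open Labelled π in
    c p ≡ c q → c p ≢ c r × c p ≢ c u × c p ≢ c v
  shared-colour-≢-others π cp≡cq =
    excludes (λ ()) (λ ()) , excludes (λ ()) (λ ()) , excludes (λ ()) (λ ())
    where
    open Labelled π
    excludes : ∀ {k} → k ≢ 0F → k ≢ 1F → c p ≢ c (π ⟨$⟩ʳ k)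
    excludes k≢0 k≢1 = shared-colour-excludes (distinct λ ()) cp≡cq (distinct k≢0) (distinct k≢1)

  distinct-colours-cover-only : ∀ π → let open Labelled π in
    c p ≡ c q → c r ≢ c u → c r ≢ c v → c u ≢ c v → CoversOnly p (c p)
  distinct-colours-cover-only π cp≡cq cr≢cu cr≢cv cu≢cv x x≢cp p-covers-x
    with shared-colour-≢-others π cp≡cq | x ≟ c (Labelled.u π) | x ≟ c (Labelled.v π)
  ... | cp≢cr , cp≢cu , cp≢cv | yes refl | _ = ¬covers-fourth-colour (swap-ru ∘ₚ π)
    (unique₄ cp≢cr cp≢cv cp≢cu cr≢cv cr≢cu (≢-sym cu≢cv)) p-covers-x
  ... | cp≢cr , cp≢cu , cp≢cv | no _ | yes refl = ¬covers-fourth-colour (swap-rv ∘ₚ π)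
    (unique₄ cp≢cu cp≢cr cp≢cv (≢-sym cr≢cu) cu≢cv cr≢cv) p-covers-x
  ... | _ , cp≢cu , cp≢cv | no x≢cu | no x≢cv = ¬covers-fourth-colour π
    (unique₄ cp≢cu cp≢cv (≢-sym x≢cp) cu≢cv (≢-sym x≢cu) (≢-sym x≢cv)) p-covers-x

  two-pairs-cover-only : ∀ π → let open Labelled π in
    c p ≡ c q → c u ≡ c v → ∀ t → γ t ≡ c r → ¬ IncidentTo p t → CoversOnly p (c p)
  two-pairs-cover-only π cp≡cq cu≡cv t t-col p∉t x x≢cp p-covers-x
    with shared-colour-≢-others π cp≡cq | shared-colour-≢-others (swap-pairs ∘ₚ π) cu≡cv
       | x ≟ c (Labelled.u π) | x ≟ c (Labelled.r π)
  ... | _ | _ | yes refl | _ = [ distinct (λ ()) , distinct (λ ()) ]′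
    (at-most-two-coverers (distinct λ ()) (covers u) v-covers p-covers-x)
    where
    open Labelled π
    v-covers : IncidentToClass γ v (c u)
    v-covers = subst (IncidentToClass γ v) (sym cu≡cv) (covers v)
  ... | _ | _ | no _ | yes refl = p∉t (p-covers-x t t-col)
  ... | cp≢cr , cp≢cu , _ | cu≢cr , _ | no x≢cu | no x≢cr = ¬covers-fourth-colour (swap-rv ∘ₚ π)
    (unique₄ cp≢cu cp≢cr (≢-sym x≢cp) cu≢cr (≢-sym x≢cu) (≢-sym x≢cr)) p-covers-x

  pair-isolated : ∀ π → let open Labelled π in
    c p ≡ c q → CoversOnly p (c p) → CoversOnly q (c q) → ∃ Isolated
  pair-isolated π cp≡cq p-only q-only =
    co-covered-isolated (c p) (distinct λ ())
      (covers p) (subst (IncidentToClass γ q) (sym cp≡cq) (covers q))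
      p-only (subst (CoversOnly q) (sym cp≡cq) q-only)
    where open Labelled π

  distinct-colours-isolated : ∀ π → let open Labelled π in
    c p ≡ c q → c r ≢ c u → c r ≢ c v → c u ≢ c v → ∃ Isolated
  distinct-colours-isolated π cp≡cq cr≢cu cr≢cv cu≢cv = pair-isolated π cp≡cq
    (distinct-colours-cover-only π cp≡cq cr≢cu cr≢cv cu≢cv)
    (distinct-colours-cover-only (swap-pq ∘ₚ π) (sym cp≡cq) cr≢cu cr≢cv cu≢cv)

  two-pairs-isolated : ∀ π → let open Labelled π in c p ≡ c q → c u ≡ c v → ∃ Isolated
  two-pairs-isolated π cp≡cq cu≡cv = [ pq-isolated , uv-isolated ]′
    (segment-at-r-misses-pq-or-uv t (covers r t t-col))
    where
    open Labelled π
    t : Seg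
    t = proj₁ (used (c r))
    t-col : γ t ≡ c r
    t-col = proj₂ (used (c r))
    pq-isolated : ¬ IncidentTo p t × ¬ IncidentTo q t → ∃ Isolated
    pq-isolated (p∉t , q∉t) = pair-isolated π cp≡cq
      (two-pairs-cover-only π cp≡cq cu≡cv t t-col p∉t)
      (two-pairs-cover-only (swap-pq ∘ₚ π) (sym cp≡cq) cu≡cv t t-col q∉t)
    uv-isolated : ¬ IncidentTo u t × ¬ IncidentTo v t → ∃ Isolated
    uv-isolated (u∉t , v∉t) = pair-isolated (swap-pairs ∘ₚ π) cu≡cv
      (two-pairs-cover-only (swap-pairs ∘ₚ π) cu≡cv cp≡cq t t-col u∉t)
      (two-pairs-cover-only (swap-pq ∘ₚ swap-pairs ∘ₚ π) (sym cu≡cv) cp≡cq t t-col v∉t)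

  shared-colour-isolated : ∀ π → let open Labelled π in c p ≡ c q → ∃ Isolated
  shared-colour-isolated π cp≡cq = by-colours (c u ≟ c v) (c r ≟ c u) (c r ≟ c v)
    where
    open Labelled π
    by-colours : Dec (c u ≡ c v) → Dec (c r ≡ c u) → Dec (c r ≡ c v) → ∃ Isolated
    by-colours (yes cu≡cv) _ _ = two-pairs-isolated π cp≡cq cu≡cv
    by-colours (no _) (yes cr≡cu) _ = two-pairs-isolated (swap-rv ∘ₚ π) cp≡cq (sym cr≡cu)
    by-colours (no _) (no _) (yes cr≡cv) = two-pairs-isolated (swap-ru ∘ₚ π) cp≡cq cr≡cv
    by-colours (no cu≢cv) (no cr≢cu) (no cr≢cv) =
      distinct-colours-isolated π cp≡cq cr≢cu cr≢cv cu≢cv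

  isolated-segment : ∃ Isolated
  isolated-segment = let π , cp≡cq = colliding-labelling c in shared-colour-isolated π cp≡cq

proposition6 : (P : Config) → GeneralPosition P → ConvexPosition P →
    (γ : Seg → Fin 4) → IsColoring P γ → AllColorsUsed γ →
    (∀ p → ∃[ c ] IsApexOfStar P γ p c) →
    ∃[ s ] ((∀ t → γ t ≡ γ s → SameSeg t s) ×
      (∀ c → c ≢ γ s → ¬ IsApexOfStar P γ (a s) c × ¬ IsApexOfStar P γ (b s) c))
proposition6 P _ _ γ _ used apex
  with FivePoints.isolated-segment γ used (λ k → proj₁ (apex k)) (λ k → proj₂ (proj₂ (apex k)))
... | s , singleton , a-only , b-only =
  s , singleton , λ x x≢γs → a-only x x≢γs ∘ proj₂ , b-only x x≢γs ∘ proj₂
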